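{- For $n\ge1$ let $b_n$ be the number of Grand-Dyck paths of semilength $n$ starting with an up step and avoiding the pattern $UDU$. Then \[\sum_{n\ge1} b_n z^n=\frac{1-3z-\sqrt{1-2z-3z^2}}{6z-2},\] i.e. $(b_n)$ is the sequence A005773 of the OEIS.
   Context: A Grand-Dyck path of semilength $n$ starting with an up step is a word with $n$ letters $U$ (step $(1,1)$) and $n$ letters $D$ (step $(1,-1)$) whose first letter is $U$. It avoids $UDU$ if it contains no three consecutive letters $U,D,U$. -}

module Defs where

open import Data.Bool using (Bool; true; false; _∧_)
open import Data.Nat using (ℕ; zero; suc; _*_; _∸_; _≡ᵇ_)
open import Data.Integer using (ℤ; +_; -[1+_]) renaming (_+_ to _+ℤ_; _*_ to _*ℤ_)
open import Data.List using (List; []; _∷_; map; _++_; filter; length; foldr; upTo)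
open import Relation.Nullary.Decidable using (Dec)
open import Data.Bool.Properties using (T?)
open import Data.Bool using (T)

-- Steps of a lattice path: U = (1,1), D = (1,-1)
data Step : Set where
  U D : Step

words : ℕ → List (List Step)
words zero    = [] ∷ []
words (suc k) = map (U ∷_) (words k) ++ map (D ∷_) (words k)

countU : List Step → ℕ
countU []       = 0
countU (U ∷ w)  = suc (countU w)
countU (D ∷ w)  = countU w

startsWithU : List Step → Bool
startsWithU (U ∷ _) = true
startsWithU _       = false

avoidsUDU : List Step → Bool
avoidsUDU []                = true
avoidsUDU (U ∷ D ∷ U ∷ _)   = false
avoidsUDU (_ ∷ w)           = avoidsUDU w

-- a word of length 2n with exactly n letters U (hence n letters D),
-- starting with U and avoiding UDU
good : ℕ → List Step → Bool
good n w = startsWithU w ∧ avoidsUDU w ∧ (countU w ≡ᵇ n)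

b : ℕ → ℕ
b n = length (filter (λ w → T? (good n w)) (words (2 * n)))

Series : Set
Series = ℕ → ℤ

sumℤ : List ℤ → ℤ
sumℤ = foldr _+ℤ_ (+ 0)

_⊛_ : Series → Series → Series
(f ⊛ g) n = sumℤ (map (λ i → f i *ℤ g (n ∸ i)) (upTo (suc n)))

poly : List ℤ → Series
poly []       n       = + 0
poly (a ∷ as) zero    = a
poly (a ∷ as) (suc n) = poly as n

_−ˢ_ : Series → Series → Series
(f −ˢ g) n = f n Data.Integer.- g n

B : Series
B zero    = + 0
B (suc n) = + b (suc n)

module Submission where

-- Keeping track of how much of the pattern UDU has just been read, the
-- UDU-avoiding words satisfy a system of recurrences in their numbers of U's
-- and D's, which is solved by b (m + 1) = c m = Σₖ C(m,k) C(m+1−k,k).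
-- A Wilf–Zeilberger certificate turns this sum into the recurrence
-- (m+3) c(m+2) = 2(m+3) c(m+1) + 3(m+1) c(m).  On the other side, a square root
-- S of Δ = 1 − 2z − 3z² satisfies the linear differential equation
-- 2Δ·zS′ = zΔ′·S, whose solutions are determined by their constant term.  The
-- recurrence for c says exactly that T = 1 − 3z − (6z − 2)B solves the same
-- equation, and T(0) = 1 = S(0).

open import Defs
open import Data.Nat using (ℕ)
open import Data.List using (List; []; _∷_)
open import Relation.Binary.PropositionalEquality using (_≡_)
open import Algebra.Bundles using (CommutativeSemiring)

module FiniteSum {c ℓ} (R : CommutativeSemiring c ℓ) where

  open import Data.Nat using (zero; suc; _∸_; _<_; _≤_; z≤n; s≤s)
  open import Data.Nat.Properties using (m≤n⇒m<n∨m≡n)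
  open import Data.Sum using (inj₁; inj₂)
  import Relation.Binary.PropositionalEquality as ≡
  open CommutativeSemiring R
  open import Algebra.Properties.CommutativeSemigroup +-commutativeSemigroup using (interchange)
  open import Relation.Binary.Reasoning.Setoid setoid

  ∑ : ℕ → (ℕ → Carrier) → Carrier
  ∑ zero    f = 0#
  ∑ (suc n) f = f 0 + ∑ n (λ i → f (suc i))

  ∑-cong : ∀ n f g → (∀ i → i < n → f i ≈ g i) → ∑ n f ≈ ∑ n g
  ∑-cong zero    f g f≈g = refl
  ∑-cong (suc n) f g f≈g =
    +-cong (f≈g 0 (s≤s z≤n)) (∑-cong n _ _ (λ i i<n → f≈g (suc i) (s≤s i<n)))

  ∑-zero : ∀ n f → (∀ i → i < n → f i ≈ 0#) → ∑ n f ≈ 0#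
  ∑-zero zero    f f≈0 = refl
  ∑-zero (suc n) f f≈0 = begin
    f 0 + ∑ n (λ i → f (suc i)) ≈⟨ +-cong (f≈0 0 (s≤s z≤n)) (∑-zero n _ (λ i i<n → f≈0 (suc i) (s≤s i<n))) ⟩
    0# + 0#                     ≈⟨ +-identityˡ 0# ⟩
    0#                          ∎

  ∑-last : ∀ n f → ∑ (suc n) f ≈ ∑ n f + f n
  ∑-last zero    f = trans (+-identityʳ (f 0)) (sym (+-identityˡ (f 0)))
  ∑-last (suc n) f = begin
    f 0 + ∑ (suc n) (λ i → f (suc i))  ≈⟨ +-congˡ (∑-last n (λ i → f (suc i))) ⟩
    f 0 + (∑ n (λ i → f (suc i)) + f (suc n)) ≈⟨ sym (+-assoc _ _ _) ⟩
    ∑ (suc n) f + f (suc n)            ∎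

  ∑-distrib-+ : ∀ n f g → ∑ n (λ i → f i + g i) ≈ ∑ n f + ∑ n g
  ∑-distrib-+ zero    f g = sym (+-identityˡ 0#)
  ∑-distrib-+ (suc n) f g = begin
    (f 0 + g 0) + ∑ n (λ i → f (suc i) + g (suc i))
      ≈⟨ +-congˡ (∑-distrib-+ n _ _) ⟩
    (f 0 + g 0) + (∑ n (λ i → f (suc i)) + ∑ n (λ i → g (suc i)))
      ≈⟨ interchange _ _ _ _ ⟩
    ∑ (suc n) f + ∑ (suc n) g
      ∎

  ∑-distribˡ-* : ∀ n a f → ∑ n (λ i → a * f i) ≈ a * ∑ n f
  ∑-distribˡ-* zero    a f = sym (zeroʳ a)
  ∑-distribˡ-* (suc n) a f =
    trans (+-congˡ (∑-distribˡ-* n a _)) (sym (distribˡ a (f 0) _))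

  ∑-comm : ∀ n m (f : ℕ → ℕ → Carrier) →
           ∑ n (λ i → ∑ m (f i)) ≈ ∑ m (λ j → ∑ n (λ i → f i j))
  ∑-comm zero    m f = sym (∑-zero m _ (λ _ _ → refl))
  ∑-comm (suc n) m f =
    trans (+-congˡ (∑-comm n m (λ i → f (suc i)))) (sym (∑-distrib-+ m (f 0) _))

  ∑-reverse : ∀ n f → ∑ n f ≈ ∑ n (λ i → f (n ∸ suc i))
  ∑-reverse zero    f = refl
  ∑-reverse (suc n) f =
    trans (∑-last n f) (trans (+-congʳ (∑-reverse n f)) (+-comm _ (f n)))

  ∑-extend : ∀ n m f → n ≤ m → (∀ i → n ≤ i → f i ≈ 0#) → ∑ m f ≈ ∑ n f
  ∑-extend n zero    f z≤n f≈0 = refl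
  ∑-extend n (suc m) f n≤1+m f≈0 with m≤n⇒m<n∨m≡n n≤1+m
  ... | inj₁ (s≤s n≤m) = begin
    ∑ (suc m) f  ≈⟨ ∑-last m f ⟩
    ∑ m f + f m  ≈⟨ +-congˡ (f≈0 m n≤m) ⟩
    ∑ m f + 0#   ≈⟨ +-identityʳ _ ⟩
    ∑ m f        ≈⟨ ∑-extend n m f n≤m f≈0 ⟩
    ∑ n f        ∎
  ... | inj₂ ≡.refl = refl

  ∑-telescope : ∀ n (f g h : ℕ → Carrier) → (∀ k → f k + h (suc k) ≈ g k + h k) → ∑ n f + h n ≈ ∑ n g + h 0
  ∑-telescope zero    f g h step = refl
  ∑-telescope (suc n) f g h step = begin
    ∑ (suc n) f + h (suc n)    ≈⟨ +-congʳ (∑-last n f) ⟩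
    (∑ n f + f n) + h (suc n)  ≈⟨ +-assoc _ _ _ ⟩
    ∑ n f + (f n + h (suc n))  ≈⟨ +-congˡ (trans (step n) (+-comm _ _)) ⟩
    ∑ n f + (h n + g n)        ≈⟨ sym (+-assoc _ _ _) ⟩
    (∑ n f + h n) + g n        ≈⟨ +-congʳ (∑-telescope n f g h step) ⟩
    (∑ n g + h 0) + g n        ≈⟨ +-assoc _ _ _ ⟩
    ∑ n g + (h 0 + g n)        ≈⟨ +-congˡ (+-comm _ _) ⟩
    ∑ n g + (g n + h 0)        ≈⟨ sym (+-assoc _ _ _) ⟩
    (∑ n g + g n) + h 0        ≈⟨ +-congʳ (sym (∑-last n g)) ⟩
    ∑ (suc n) g + h 0          ∎

module Binomial where

  open import Data.Empty using (⊥-elim)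
  open import Data.Nat using (zero; suc; _+_; _*_; _∸_; _<_; s≤s; z≤n; _≤?_)
  open import Data.Nat.Properties
  open import Relation.Nullary using (yes; no)
  open import Relation.Binary.PropositionalEquality

  open FiniteSum +-*-commutativeSemiring

  C : ℕ → ℕ → ℕ
  C n       zero    = 1
  C zero    (suc k) = 0
  C (suc n) (suc k) = C n k + C n (suc k)

  C-vanish : ∀ {n k} → n < k → C n k ≡ 0
  C-vanish {zero}  {suc k} _         = refl
  C-vanish {suc n} {suc k} (s≤s n<k) = cong₂ _+_ (C-vanish n<k) (C-vanish (m≤n⇒m≤1+n n<k))

  C-diagonal : ∀ n → C n n ≡ 1
  C-diagonal zero    = refl
  C-diagonal (suc n) = cong₂ _+_ (C-diagonal n) (C-vanish (n<1+n n))

  C-one : ∀ n → C n 1 ≡ n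
  C-one zero    = refl
  C-one (suc n) = cong suc (C-one n)

  C-absorption : ∀ n k → suc k * C (suc n) (suc k) ≡ suc n * C n k
  C-absorption zero    zero    = refl
  C-absorption zero    (suc k) = *-zeroʳ (suc (suc k))
  C-absorption (suc n) zero    = trans (+-identityʳ _) (trans (C-one (suc (suc n))) (sym (*-identityʳ (suc (suc n)))))
  C-absorption (suc n) (suc k) = begin
      suc (suc k) * (C (suc n) (suc k) + C (suc n) (suc (suc k)))
    ≡⟨ *-distribˡ-+ (suc (suc k)) (C (suc n) (suc k)) _ ⟩
      suc (suc k) * C (suc n) (suc k) + suc (suc k) * C (suc n) (suc (suc k))
    ≡⟨ cong (suc (suc k) * C (suc n) (suc k) +_) (C-absorption n (suc k)) ⟩
      (C (suc n) (suc k) + suc k * C (suc n) (suc k)) + suc n * C n (suc k)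
    ≡⟨ cong (λ x → (C (suc n) (suc k) + x) + suc n * C n (suc k)) (C-absorption n k) ⟩
      (C (suc n) (suc k) + suc n * C n k) + suc n * C n (suc k)
    ≡⟨ +-assoc (C (suc n) (suc k)) _ _ ⟩
      C (suc n) (suc k) + (suc n * C n k + suc n * C n (suc k))
    ≡⟨ cong (C (suc n) (suc k) +_) (sym (*-distribˡ-+ (suc n) (C n k) _)) ⟩
      C (suc n) (suc k) + suc n * C (suc n) (suc k)
    ∎
    where open ≡-Reasoning

  C-lower-step : ∀ a k n → a + k ≡ n → suc k * C n (suc k) ≡ a * C n k
  C-lower-step a k _ refl = +-cancelˡ-≡ (suc k * C (a + k) k) _ _ (begin
      suc k * C (a + k) k + suc k * C (a + k) (suc k)
    ≡⟨ sym (*-distribˡ-+ (suc k) (C (a + k) k) _) ⟩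
      suc k * C (suc (a + k)) (suc k)
    ≡⟨ C-absorption (a + k) k ⟩
      suc (a + k) * C (a + k) k
    ≡⟨ cong (λ x → suc x * C (a + k) k) (+-comm a k) ⟩
      (suc k + a) * C (a + k) k
    ≡⟨ *-distribʳ-+ (C (a + k) k) (suc k) a ⟩
      suc k * C (a + k) k + a * C (a + k) k
    ∎)
    where open ≡-Reasoning

  C-upper-step : ∀ a k n → a + k ≡ n → suc a * C (suc n) k ≡ suc n * C n k
  C-upper-step a k _ refl = trans (sym (C-lower-step (suc a) k (suc (a + k)) refl)) (C-absorption (a + k) k)

  pascal-∸ : ∀ a k → C (suc a ∸ k) (suc k) ≡ C (a ∸ k) (suc k) + C (a ∸ k) k
  pascal-∸ a k with k ≤? a
  ... | yes k≤a rewrite +-∸-assoc 1 k≤a = +-comm (C (a ∸ k) k) _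
  pascal-∸ a zero    | no k≰a = ⊥-elim (k≰a z≤n)
  pascal-∸ a (suc k) | no k≰a rewrite m≤n⇒m∸n≡0 (≰⇒> k≰a) | m≤n⇒m∸n≡0 (≤-trans (n≤1+n a) (≰⇒> k≰a)) = refl

  hockey-stick : ∀ d k → ∑ (suc d) (λ e → C (e ∸ k) k) ≡ C (suc d ∸ k) (suc k)
  hockey-stick zero    zero          = refl
  hockey-stick zero    (suc zero)    = refl
  hockey-stick zero    (suc (suc k)) = refl
  hockey-stick (suc d) k = begin
      ∑ (suc (suc d)) (λ e → C (e ∸ k) k)
    ≡⟨ ∑-last (suc d) (λ e → C (e ∸ k) k) ⟩
      ∑ (suc d) (λ e → C (e ∸ k) k) + C (suc d ∸ k) k
    ≡⟨ cong (_+ C (suc d ∸ k) k) (hockey-stick d k) ⟩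
      C (suc d ∸ k) (suc k) + C (suc d ∸ k) k
    ≡⟨ sym (pascal-∸ (suc d) k) ⟩
      C (suc (suc d) ∸ k) (suc k)
    ∎
    where open ≡-Reasoning

module UDUAvoidingPaths where

  open import Data.Bool using (Bool; true; false; _∧_)
  open import Data.Bool.Properties using (T?; ∧-zeroʳ)
  open import Data.List using (map; _++_; filter; length)
  open import Data.List.Properties using (filter-++; length-++)
  open import Data.Nat using (zero; suc; _+_; _*_; _∸_; _≡ᵇ_; _<_; s≤s; z≤n)
  open import Data.Nat.Properties
  open import Function using (_∘_)
  open import Relation.Binary.PropositionalEquality
  open Binomial

  open FiniteSum +-*-commutativeSemiring

  count : {A : Set} → (A → Bool) → List A → ℕ
  count p = length ∘ filter (T? ∘ p)

  count-++ : {A : Set} (p : A → Bool) (xs ys : List A) → count p (xs ++ ys) ≡ count p xs + count p ys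
  count-++ p xs ys = trans (cong length (filter-++ (T? ∘ p) xs ys)) (length-++ (filter (T? ∘ p) xs))

  count-map : {A B : Set} (p : B → Bool) (f : A → B) (xs : List A) → count p (map f xs) ≡ count (p ∘ f) xs
  count-map p f []       = refl
  count-map p f (x ∷ xs) with p (f x)
  ... | true  = cong suc (count-map p f xs)
  ... | false = count-map p f xs

  count-none : {A : Set} (p : A → Bool) (xs : List A) → (∀ x → p x ≡ false) → count p xs ≡ 0
  count-none p []       p≡false = refl
  count-none p (x ∷ xs) p≡false rewrite p≡false x = count-none p xs p≡false

  count-words-suc : ∀ p L → count p (words (suc L)) ≡ count (p ∘ (U ∷_)) (words L) + count (p ∘ (D ∷_)) (words L)
  count-words-suc p L =
    trans (count-++ p (map (U ∷_) (words L)) (map (D ∷_) (words L)))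
          (cong₂ _+_ (count-map p (U ∷_) (words L)) (count-map p (D ∷_) (words L)))

  data Context : Set where
    start afterU afterUD : Context

  prefix : Context → List Step
  prefix start   = []
  prefix afterU  = U ∷ []
  prefix afterUD = U ∷ D ∷ []

  ways : Context → ℕ → ℕ → ℕ
  ways c L u = count (λ w → avoidsUDU (prefix c ++ w) ∧ (countU w ≡ᵇ u)) (words L)

  no-ups-after-U : ∀ c L → count (λ w → avoidsUDU (prefix c ++ U ∷ w) ∧ (suc (countU w) ≡ᵇ 0)) (words L) ≡ 0
  no-ups-after-U c L = count-none _ (words L) (λ w → ∧-zeroʳ (avoidsUDU (prefix c ++ U ∷ w)))

  ways-start-zero : ∀ L → ways start (suc L) 0 ≡ ways start L 0
  ways-start-zero L = trans (count-words-suc _ L) (cong (_+ ways start L 0) (no-ups-after-U start L))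

  ways-start-suc : ∀ L u → ways start (suc L) (suc u) ≡ ways afterU L u + ways start L (suc u)
  ways-start-suc L u = count-words-suc _ L

  ways-afterU-zero : ∀ L → ways afterU (suc L) 0 ≡ ways afterUD L 0
  ways-afterU-zero L = trans (count-words-suc _ L) (cong (_+ ways afterUD L 0) (no-ups-after-U afterU L))

  ways-afterU-suc : ∀ L u → ways afterU (suc L) (suc u) ≡ ways afterU L u + ways afterUD L (suc u)
  ways-afterU-suc L u = count-words-suc _ L

  ways-afterUD : ∀ L u → ways afterUD (suc L) u ≡ ways start L u
  ways-afterUD L u = trans (count-words-suc _ L) (cong (_+ ways start L u) (count-none _ (words L) (λ _ → refl)))

  ways-vanish : ∀ c L u → L < u → ways c L u ≡ 0
  ways-vanish start   zero    (suc u) _ = refl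
  ways-vanish afterU  zero    (suc u) _ = refl
  ways-vanish afterUD zero    (suc u) _ = refl
  ways-vanish start   (suc L) (suc u) (s≤s L<u) =
    trans (ways-start-suc L u) (cong₂ _+_ (ways-vanish afterU L u L<u) (ways-vanish start L (suc u) (m≤n⇒m≤1+n L<u)))
  ways-vanish afterU  (suc L) (suc u) (s≤s L<u) =
    trans (ways-afterU-suc L u) (cong₂ _+_ (ways-vanish afterU L u L<u) (ways-vanish afterUD L (suc u) (m≤n⇒m≤1+n L<u)))
  ways-vanish afterUD (suc L) (suc u) (s≤s L<u) =
    trans (ways-afterUD L (suc u)) (ways-vanish start L (suc u) (m≤n⇒m≤1+n L<u))

  paths : Context → ℕ → ℕ → ℕ
  paths c u d = ways c (u + d) u

  u+0<1+u : ∀ u → u + 0 < suc u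
  u+0<1+u u = s≤s (≤-reflexive (+-identityʳ u))

  paths-start-no-U : ∀ d → paths start 0 d ≡ 1
  paths-start-no-U zero    = refl
  paths-start-no-U (suc d) = trans (ways-start-zero d) (paths-start-no-U d)

  paths-afterU-no-U : ∀ d → paths afterU 0 d ≡ 1
  paths-afterU-no-U zero          = refl
  paths-afterU-no-U (suc zero)    = refl
  paths-afterU-no-U (suc (suc d)) =
    trans (ways-afterU-zero (suc d)) (trans (ways-afterUD d 0) (paths-start-no-U d))

  paths-afterU-no-D : ∀ u → paths afterU u 0 ≡ 1
  paths-afterU-no-D zero    = refl
  paths-afterU-no-D (suc u) = begin
    paths afterU (suc u) 0                               ≡⟨ ways-afterU-suc (u + 0) u ⟩
    paths afterU u 0 + ways afterUD (u + 0) (suc u)      ≡⟨ cong (paths afterU u 0 +_) (ways-vanish afterUD (u + 0) (suc u) (u+0<1+u u)) ⟩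
    paths afterU u 0 + 0                                 ≡⟨ +-identityʳ _ ⟩
    paths afterU u 0                                     ≡⟨ paths-afterU-no-D u ⟩
    1                                                    ∎
    where open ≡-Reasoning

  paths-afterU-one-D : ∀ u → paths afterU u 1 ≡ 1
  paths-afterU-one-D zero    = refl
  paths-afterU-one-D (suc u) = begin
    paths afterU (suc u) 1                                 ≡⟨ ways-afterU-suc (u + 1) u ⟩
    paths afterU u 1 + ways afterUD (u + 1) (suc u)        ≡⟨ cong (λ L → paths afterU u 1 + ways afterUD L (suc u)) (+-suc u 0) ⟩
    paths afterU u 1 + ways afterUD (suc (u + 0)) (suc u)  ≡⟨ cong (paths afterU u 1 +_) (ways-afterUD (u + 0) (suc u)) ⟩
    paths afterU u 1 + ways start (u + 0) (suc u)          ≡⟨ cong (paths afterU u 1 +_) (ways-vanish start (u + 0) (suc u) (u+0<1+u u)) ⟩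
    paths afterU u 1 + 0                                   ≡⟨ +-identityʳ _ ⟩
    paths afterU u 1                                       ≡⟨ paths-afterU-one-D u ⟩
    1                                                      ∎
    where open ≡-Reasoning

  paths-start-suc : ∀ u d → paths start (suc u) d ≡ ∑ (suc d) (paths afterU u)
  paths-start-suc u zero = begin
    paths start (suc u) 0                          ≡⟨ ways-start-suc (u + 0) u ⟩
    paths afterU u 0 + ways start (u + 0) (suc u)  ≡⟨ cong (paths afterU u 0 +_) (ways-vanish start (u + 0) (suc u) (u+0<1+u u)) ⟩
    paths afterU u 0 + 0                           ∎
    where open ≡-Reasoning
  paths-start-suc u (suc d) = begin
    paths start (suc u) (suc d)                              ≡⟨ ways-start-suc (u + suc d) u ⟩
    paths afterU u (suc d) + ways start (u + suc d) (suc u)  ≡⟨ cong (λ L → paths afterU u (suc d) + ways start L (suc u)) (+-suc u d) ⟩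
    paths afterU u (suc d) + paths start (suc u) d           ≡⟨ cong (paths afterU u (suc d) +_) (paths-start-suc u d) ⟩
    paths afterU u (suc d) + ∑ (suc d) (paths afterU u)      ≡⟨ +-comm (paths afterU u (suc d)) _ ⟩
    ∑ (suc d) (paths afterU u) + paths afterU u (suc d)      ≡⟨ ∑-last (suc d) (paths afterU u) ⟨
    ∑ (suc (suc d)) (paths afterU u)                         ∎
    where open ≡-Reasoning

  paths-afterU-suc : ∀ u d → paths afterU (suc u) (suc (suc d)) ≡ paths afterU u (suc (suc d)) + paths start (suc u) d
  paths-afterU-suc u d = begin
    paths afterU (suc u) (suc (suc d))                                     ≡⟨ ways-afterU-suc (u + suc (suc d)) u ⟩
    paths afterU u (suc (suc d)) + ways afterUD (u + suc (suc d)) (suc u)  ≡⟨ cong (λ L → P + ways afterUD L (suc u)) (+-suc u (suc d)) ⟩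
    paths afterU u (suc (suc d)) + ways afterUD (suc (u + suc d)) (suc u)  ≡⟨ cong (P +_) (ways-afterUD (u + suc d) (suc u)) ⟩
    paths afterU u (suc (suc d)) + ways start (u + suc d) (suc u)          ≡⟨ cong (λ L → P + ways start L (suc u)) (+-suc u d) ⟩
    paths afterU u (suc (suc d)) + paths start (suc u) d                   ∎
    where
    open ≡-Reasoning
    P = paths afterU u (suc (suc d))

  binomialSum : ℕ → ℕ → ℕ → ℕ
  binomialSum K u d = ∑ K (λ k → C u k * C (d ∸ k) k)

  binomialSum-no-U : ∀ K d → binomialSum (suc K) 0 d ≡ 1
  binomialSum-no-U K d = cong (1 +_) (∑-zero K _ (λ _ _ → refl))

  binomialSum-no-D : ∀ K u → binomialSum (suc K) u 0 ≡ 1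
  binomialSum-no-D K u = cong (1 +_) (∑-zero K _ (λ k _ → *-zeroʳ (C u (suc k))))

  binomialSum-one-D : ∀ K u → binomialSum (suc K) u 1 ≡ 1
  binomialSum-one-D K u = cong (1 +_) (∑-zero K (λ k → C u (suc k) * C (0 ∸ k) (suc k)) (λ k _ →
    trans (cong (C u (suc k) *_) (C-vanish (s≤s (≤-trans (m∸n≤m 0 k) z≤n)))) (*-zeroʳ (C u (suc k)))))

  paths-afterU-closed : ∀ K u d → d < K → paths afterU u d ≡ binomialSum K u d
  paths-afterU-closed (suc K) zero    d             _ = trans (paths-afterU-no-U d) (sym (binomialSum-no-U K d))
  paths-afterU-closed (suc K) (suc u) zero          _ = trans (paths-afterU-no-D (suc u)) (sym (binomialSum-no-D K (suc u)))
  paths-afterU-closed (suc K) (suc u) (suc zero)    _ = trans (paths-afterU-one-D (suc u)) (sym (binomialSum-one-D K (suc u)))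
  paths-afterU-closed (suc K) (suc u) (suc (suc d)) d<K = begin
      paths afterU (suc u) (suc (suc d))
    ≡⟨ paths-afterU-suc u d ⟩
      paths afterU u (suc (suc d)) + paths start (suc u) d
    ≡⟨ cong₂ _+_ (paths-afterU-closed (suc K) u (suc (suc d)) d<K) (paths-start-suc u d) ⟩
      binomialSum (suc K) u (suc (suc d)) + ∑ (suc d) (paths afterU u)
    ≡⟨ cong (binomialSum (suc K) u (suc (suc d)) +_) shorter-paths ⟩
      (1 + Y) + (Y′ + 0)
    ≡⟨ cong (λ x → 1 + Y + x) (+-identityʳ Y′) ⟩
      1 + Y + Y′
    ≡⟨ cong suc (+-comm Y Y′) ⟩
      1 + (Y′ + Y)
    ≡⟨ cong (1 +_) (∑-distrib-+ K _ _) ⟨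
      1 + ∑ K (λ k → C u k * C (suc d ∸ k) (suc k) + C u (suc k) * C (suc d ∸ k) (suc k))
    ≡⟨ cong (1 +_) (∑-cong K _ _ (λ k _ → *-distribʳ-+ (C (suc d ∸ k) (suc k)) (C u k) (C u (suc k)))) ⟨
      binomialSum (suc K) (suc u) (suc (suc d))
    ∎
    where
    open ≡-Reasoning
    Y  = ∑ K (λ k → C u (suc k) * C (suc d ∸ k) (suc k))
    Y′ = ∑ K (λ k → C u k * C (suc d ∸ k) (suc k))
    1+d<K : suc d < K
    1+d<K = ≤-pred d<K
    shorter-paths : ∑ (suc d) (paths afterU u) ≡ Y′ + 0
    shorter-paths = begin
        ∑ (suc d) (paths afterU u)
      ≡⟨ ∑-cong (suc d) _ _ (λ e e<1+d → paths-afterU-closed (suc K) u e (m<n⇒m<1+n (<-trans e<1+d 1+d<K))) ⟩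
        ∑ (suc d) (λ e → ∑ (suc K) (λ k → C u k * C (e ∸ k) k))
      ≡⟨ ∑-comm (suc d) (suc K) (λ e k → C u k * C (e ∸ k) k) ⟩
        ∑ (suc K) (λ k → ∑ (suc d) (λ e → C u k * C (e ∸ k) k))
      ≡⟨ ∑-cong (suc K) _ _ (λ k _ → trans (∑-distribˡ-* (suc d) (C u k) (λ e → C (e ∸ k) k)) (cong (C u k *_) (hockey-stick d k))) ⟩
        ∑ (suc K) (λ k → C u k * C (suc d ∸ k) (suc k))
      ≡⟨ ∑-last K _ ⟩
        Y′ + C u K * C (suc d ∸ K) (suc K)
      ≡⟨ cong (λ x → Y′ + C u K * C x (suc K)) (m≤n⇒m∸n≡0 (<⇒≤ 1+d<K)) ⟩
        Y′ + C u K * 0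
      ≡⟨ cong (Y′ +_) (*-zeroʳ (C u K)) ⟩
        Y′ + 0
      ∎

  b-suc≡paths : ∀ m → b (suc m) ≡ paths afterU m (suc m)
  b-suc≡paths m = begin
      b (suc m)
    ≡⟨ count-words-suc (good (suc m)) (m + (suc m + 0)) ⟩
      ways afterU (m + (suc m + 0)) m + count (good (suc m) ∘ (D ∷_)) (words (m + (suc m + 0)))
    ≡⟨ cong (ways afterU (m + (suc m + 0)) m +_) (count-none _ (words (m + (suc m + 0))) (λ _ → refl)) ⟩
      ways afterU (m + (suc m + 0)) m + 0
    ≡⟨ +-identityʳ _ ⟩
      ways afterU (m + (suc m + 0)) m
    ≡⟨ cong (λ L → ways afterU (m + L) m) (+-identityʳ (suc m)) ⟩
      paths afterU m (suc m)
    ∎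
    where open ≡-Reasoning

module Recurrence where

  open import Data.Nat using (zero; suc; _+_; _*_; _∸_; _<_; s≤s; _<?_)
  open import Data.Nat.Properties
  open import Data.Nat.Tactic.RingSolver
  open import Relation.Nullary using (yes; no)
  open import Relation.Binary.PropositionalEquality
  open Binomial
  open UDUAvoidingPaths using (paths; afterU; binomialSum; paths-afterU-closed; b-suc≡paths)

  open FiniteSum +-*-commutativeSemiring

  F : ℕ → ℕ → ℕ
  F m k = C m k * C (suc m ∸ k) k

  -- The Wilf–Zeilberger certificate for the recurrence satisfied by ∑ₖ F m k.
  G : ℕ → ℕ → ℕ
  G m zero    = 0
  G m (suc k) = 2 * ((3 + 2 * m) ∸ 2 * k) * (C (1 + m) k * C ((1 + m) ∸ k) k)

  Telescoping : ℕ → ℕ → Set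
  Telescoping m k = (3 + m) * F (2 + m) k + G m (suc k) ≡ (2 * (3 + m) * F (1 + m) k + 3 * (1 + m) * F m k) + G m k

  ∸-≡ : ∀ x y z → x ≡ z + y → x ∸ y ≡ z
  ∸-≡ _ y z refl = m+n∸n≡m z y

  ratio-product : ∀ p q α β A B A′ B′ → p * A ≡ α * A′ → q * B ≡ β * B′ → (p * q) * (A * B) ≡ (α * β) * (A′ * B′)
  ratio-product p q α β A B A′ B′ pA≡αA′ qB≡βB′ = begin
    (p * q) * (A * B)    ≡⟨ [m*n]*[o*p]≡[m*o]*[n*p] p q A B ⟩
    (p * A) * (q * B)    ≡⟨ cong₂ _*_ pA≡αA′ qB≡βB′ ⟩
    (α * A′) * (β * B′)  ≡⟨ [m*n]*[o*p]≡[m*o]*[n*p] α A′ β B′ ⟩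
    (α * β) * (A′ * B′)  ∎
    where open ≡-Reasoning

  ratio-trans : ∀ p q α β A M A′ → p * A ≡ α * M → q * M ≡ β * A′ → (q * p) * A ≡ (α * β) * A′
  ratio-trans p q α β A M A′ pA≡αM qM≡βA′ = begin
    (q * p) * A    ≡⟨ *-assoc q p A ⟩
    q * (p * A)    ≡⟨ cong (q *_) pA≡αM ⟩
    q * (α * M)    ≡⟨ solve (q ∷ α ∷ M ∷ []) ⟩
    α * (q * M)    ≡⟨ cong (α *_) qM≡βA′ ⟩
    α * (β * A′)   ≡⟨ *-assoc α β A′ ⟨
    (α * β) * A′   ∎
    where open ≡-Reasoning

  -- Each binomial is a rational multiple of A₀ or B₀; clearing the common
  -- denominator leaves a polynomial identity.
  interior-core : ∀ s i m A₁ B₁ A₂ B₂ A₃ B₃ A₀ B₀ → 2 * s + i ≡ m →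
    (1 + s) * A₁ ≡ (2 + m) * A₀ →
    (1 + s) * B₁ ≡ (2 + (s + i)) * B₀ →
    (1 + s) * A₂ ≡ (1 + (s + i)) * A₀ →
    (1 + s) * B₂ ≡ (1 + i) * B₀ →
    ((1 + m) * (1 + s)) * A₃ ≡ ((s + i) * (1 + (s + i))) * A₀ →
    ((1 + (s + i)) * (1 + s)) * B₃ ≡ (i * (1 + i)) * B₀ →
    (3 + m) * (A₁ * B₁) + 2 * (2 * s + 2 * i + 1) * (A₂ * B₃)
      ≡ (2 * (3 + m) * (A₂ * B₂) + 3 * (1 + m) * (A₃ * B₃)) + 2 * (2 * s + 2 * i + 3) * (A₀ * B₀)
  interior-core s i m A₁ B₁ A₂ B₂ A₃ B₃ A₀ B₀ refl r₁ r₂ r₃ r₄ r₅ r₆ =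
    *-cancelˡ-≡ _ _ ((1 + m) * (1 + (s + i)) * (1 + s) * (1 + s)) (begin
      (1 + m) * (1 + (s + i)) * (1 + s) * (1 + s) * ((3 + m) * (A₁ * B₁) + 2 * (2 * s + 2 * i + 1) * (A₂ * B₃))
    ≡⟨ solve (s ∷ i ∷ A₁ ∷ B₁ ∷ A₂ ∷ B₃ ∷ []) ⟩
      (3 + m) * (1 + m) * (1 + (s + i)) * (((1 + s) * (1 + s)) * (A₁ * B₁))
        + 2 * (2 * s + 2 * i + 1) * (1 + m) * (((1 + s) * ((1 + (s + i)) * (1 + s))) * (A₂ * B₃))
    ≡⟨ cong₂ (λ x y → (3 + m) * (1 + m) * (1 + (s + i)) * x + 2 * (2 * s + 2 * i + 1) * (1 + m) * y)
         (ratio-product (1 + s) (1 + s) (2 + m) (2 + (s + i)) A₁ B₁ A₀ B₀ r₁ r₂) (ratio-product (1 + s) ((1 + (s + i)) * (1 + s)) (1 + (s + i)) (i * (1 + i)) A₂ B₃ A₀ B₀ r₃ r₆) ⟩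
      (3 + m) * (1 + m) * (1 + (s + i)) * (((2 + m) * (2 + (s + i))) * (A₀ * B₀))
        + 2 * (2 * s + 2 * i + 1) * (1 + m) * (((1 + (s + i)) * (i * (1 + i))) * (A₀ * B₀))
    ≡⟨ solve (s ∷ i ∷ A₀ ∷ B₀ ∷ []) ⟩
      2 * (3 + m) * (1 + m) * (1 + (s + i)) * (((1 + (s + i)) * (1 + i)) * (A₀ * B₀))
        + 3 * (1 + m) * ((((s + i) * (1 + (s + i))) * (i * (1 + i))) * (A₀ * B₀))
        + 2 * (2 * s + 2 * i + 3) * ((1 + m) * (1 + (s + i)) * (1 + s) * (1 + s) * (A₀ * B₀))
    ≡⟨ cong₂ (λ x y → 2 * (3 + m) * (1 + m) * (1 + (s + i)) * x + 3 * (1 + m) * y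
                       + 2 * (2 * s + 2 * i + 3) * ((1 + m) * (1 + (s + i)) * (1 + s) * (1 + s) * (A₀ * B₀)))
         (ratio-product (1 + s) (1 + s) (1 + (s + i)) (1 + i) A₂ B₂ A₀ B₀ r₃ r₄) (ratio-product ((1 + m) * (1 + s)) ((1 + (s + i)) * (1 + s)) ((s + i) * (1 + (s + i))) (i * (1 + i)) A₃ B₃ A₀ B₀ r₅ r₆) ⟨
      2 * (3 + m) * (1 + m) * (1 + (s + i)) * (((1 + s) * (1 + s)) * (A₂ * B₂))
        + 3 * (1 + m) * ((((1 + m) * (1 + s)) * ((1 + (s + i)) * (1 + s))) * (A₃ * B₃))
        + 2 * (2 * s + 2 * i + 3) * ((1 + m) * (1 + (s + i)) * (1 + s) * (1 + s) * (A₀ * B₀))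
    ≡⟨ solve (s ∷ i ∷ A₂ ∷ B₂ ∷ A₃ ∷ B₃ ∷ A₀ ∷ B₀ ∷ []) ⟩
      (1 + m) * (1 + (s + i)) * (1 + s) * (1 + s) * ((2 * (3 + m) * (A₂ * B₂) + 3 * (1 + m) * (A₃ * B₃)) + 2 * (2 * s + 2 * i + 3) * (A₀ * B₀))
    ∎)
    where open ≡-Reasoning

  telescoping-interior : ∀ s i → Telescoping (2 * s + i) (suc s)
  telescoping-interior s i = begin
      (3 + m) * (A₁ * C ((2 + m) ∸ s) (suc s)) + 2 * ((3 + 2 * m) ∸ 2 * suc s) * (A₂ * C (m ∸ s) (suc s))
    ≡⟨ cong₂ _+_ (cong (λ x → (3 + m) * (A₁ * C x (suc s))) e₁) (cong₂ (λ x y → 2 * x * (A₂ * C y (suc s))) e₄ e₃) ⟩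
      (3 + m) * (A₁ * B₁) + 2 * (2 * s + 2 * i + 1) * (A₂ * B₃)
    ≡⟨ interior-core s i m A₁ B₁ A₂ B₂ A₃ B₃ A₀ B₀ refl
         (C-absorption (1 + m) s) (C-absorption (1 + (s + i)) s)
         (C-lower-step (1 + (s + i)) s (1 + (2 * s + i)) (cong suc (solve (s ∷ i ∷ []))))
         (C-lower-step (1 + i) s (1 + (s + i)) (cong suc (+-comm i s)))
         (ratio-trans (1 + s) (1 + m) (s + i) (1 + (s + i)) A₃ (C m s) A₀
           (C-lower-step (s + i) s (2 * s + i) (solve (s ∷ i ∷ []))) (sym (C-upper-step (s + i) s (2 * s + i) (solve (s ∷ i ∷ [])))))
         (ratio-trans (1 + s) (1 + (s + i)) i (1 + i) B₃ (C (s + i) s) B₀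
           (C-lower-step i s (s + i) (+-comm i s)) (sym (C-upper-step i s (s + i) (+-comm i s)))) ⟩
      (2 * (3 + m) * (A₂ * B₂) + 3 * (1 + m) * (A₃ * B₃)) + 2 * (2 * s + 2 * i + 3) * (A₀ * B₀)
    ≡⟨ cong₂ _+_ (cong₂ (λ x y → 2 * (3 + m) * (A₂ * C x (suc s)) + 3 * (1 + m) * (A₃ * C y (suc s))) e₂ e₃)
                 (cong₂ (λ x y → 2 * x * (A₀ * C y s)) e₅ e₂) ⟨
      (2 * (3 + m) * (A₂ * C ((1 + m) ∸ s) (suc s)) + 3 * (1 + m) * (A₃ * C (m ∸ s) (suc s)))
        + 2 * ((3 + 2 * m) ∸ 2 * s) * (A₀ * C ((1 + m) ∸ s) s)
    ∎
    where
    open ≡-Reasoning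
    m  = 2 * s + i
    A₁ = C (2 + m) (suc s)
    B₁ = C (2 + (s + i)) (suc s)
    A₂ = C (1 + m) (suc s)
    B₂ = C (1 + (s + i)) (suc s)
    A₃ = C m (suc s)
    B₃ = C (s + i) (suc s)
    A₀  = C (1 + m) s
    B₀  = C (1 + (s + i)) s
    e₁ : (2 + (2 * s + i)) ∸ s ≡ 2 + (s + i)
    e₁ = ∸-≡ (2 + (2 * s + i)) s (2 + (s + i)) (solve (s ∷ i ∷ []))
    e₂ : (1 + (2 * s + i)) ∸ s ≡ 1 + (s + i)
    e₂ = ∸-≡ (1 + (2 * s + i)) s (1 + (s + i)) (solve (s ∷ i ∷ []))
    e₃ : (2 * s + i) ∸ s ≡ s + i
    e₃ = ∸-≡ (2 * s + i) s (s + i) (solve (s ∷ i ∷ []))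
    e₄ : (3 + 2 * (2 * s + i)) ∸ 2 * suc s ≡ 2 * s + 2 * i + 1
    e₄ = ∸-≡ (3 + 2 * (2 * s + i)) (2 * suc s) (2 * s + 2 * i + 1) (solve (s ∷ i ∷ []))
    e₅ : (3 + 2 * (2 * s + i)) ∸ 2 * s ≡ 2 * s + 2 * i + 3
    e₅ = ∸-≡ (3 + 2 * (2 * s + i)) (2 * s) (2 * s + 2 * i + 3) (solve (s ∷ i ∷ []))

  telescoping-zero : ∀ m → Telescoping m 0
  telescoping-zero m = expanded m
    where
    expanded : ∀ m → (3 + m) * (1 * 1) + 2 * (3 + 2 * m) * (1 * 1) ≡ (2 * (3 + m) * (1 * 1) + 3 * (1 + m) * (1 * 1)) + 0
    expanded = solve-∀

  edge-core : ∀ t A₁ A₂ A₃ A₀ q → (2 + t) * A₁ ≡ (2 + (2 * t + 1)) * A₀ →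
    (3 + (2 * t + 1)) * (A₁ * 1) + 2 * q * (A₂ * 0)
      ≡ (2 * (3 + (2 * t + 1)) * (A₂ * 0) + 3 * (1 + (2 * t + 1)) * (A₃ * 0)) + 2 * (2 * t + 3) * (A₀ * 1)
  edge-core t A₁ A₂ A₃ A₀ q ratio = begin
    (3 + (2 * t + 1)) * (A₁ * 1) + 2 * q * (A₂ * 0)    ≡⟨ solve (t ∷ A₁ ∷ A₂ ∷ q ∷ []) ⟩
    2 * ((2 + t) * A₁)                                   ≡⟨ cong (2 *_) ratio ⟩
    2 * ((2 + (2 * t + 1)) * A₀)                         ≡⟨ solve (t ∷ A₂ ∷ A₃ ∷ A₀ ∷ []) ⟩
    (2 * (3 + (2 * t + 1)) * (A₂ * 0) + 3 * (1 + (2 * t + 1)) * (A₃ * 0)) + 2 * (2 * t + 3) * (A₀ * 1)  ∎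
    where open ≡-Reasoning

  telescoping-edge : ∀ t → Telescoping (2 * t + 1) (suc (suc t))
  telescoping-edge t = begin
      (3 + m) * (A₁ * C ((1 + m) ∸ t) (2 + t)) + 2 * q * (A₂ * C (m ∸ suc t) (2 + t))
    ≡⟨ cong₂ (λ x y → (3 + m) * (A₁ * C x (2 + t)) + 2 * q * (A₂ * C y (2 + t))) e₁ e₂ ⟩
      (3 + m) * (A₁ * C (2 + t) (2 + t)) + 2 * q * (A₂ * C t (2 + t))
    ≡⟨ cong₂ (λ x y → (3 + m) * (A₁ * x) + 2 * q * (A₂ * y)) (C-diagonal (2 + t)) (C-vanish t<2+t) ⟩
      (3 + m) * (A₁ * 1) + 2 * q * (A₂ * 0)
    ≡⟨ edge-core t A₁ A₂ A₃ A₀ q (C-absorption (1 + m) (suc t)) ⟩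
      (2 * (3 + m) * (A₂ * 0) + 3 * (1 + m) * (A₃ * 0)) + 2 * (2 * t + 3) * (A₀ * 1)
    ≡⟨ cong₂ (λ x y → (2 * (3 + m) * (A₂ * x) + 3 * (1 + m) * (A₃ * 0)) + 2 * (2 * t + 3) * (A₀ * y))
         (C-vanish (n<1+n (suc t))) (C-diagonal (suc t)) ⟨
      (2 * (3 + m) * (A₂ * C (suc t) (2 + t)) + 3 * (1 + m) * (A₃ * 0)) + 2 * (2 * t + 3) * (A₀ * C (suc t) (suc t))
    ≡⟨ cong (λ y → (2 * (3 + m) * (A₂ * C (suc t) (2 + t)) + 3 * (1 + m) * (A₃ * y)) + 2 * (2 * t + 3) * (A₀ * C (suc t) (suc t)))
         (trans (cong (λ x → C x (2 + t)) e₂) (C-vanish t<2+t)) ⟨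
      (2 * (3 + m) * (A₂ * C (suc t) (2 + t)) + 3 * (1 + m) * (A₃ * C (m ∸ suc t) (2 + t))) + 2 * (2 * t + 3) * (A₀ * C (suc t) (suc t))
    ≡⟨ cong₂ (λ x z → (2 * (3 + m) * (A₂ * C x (2 + t)) + 3 * (1 + m) * (A₃ * C (m ∸ suc t) (2 + t))) + 2 * z * (A₀ * C x (suc t)))
         e₃ e₄ ⟨
      (2 * (3 + m) * (A₂ * C (m ∸ t) (2 + t)) + 3 * (1 + m) * (A₃ * C (m ∸ suc t) (2 + t)))
        + 2 * ((3 + 2 * m) ∸ 2 * suc t) * (A₀ * C (m ∸ t) (suc t))
    ∎
    where
    open ≡-Reasoning
    m  = 2 * t + 1
    A₁  = C (2 + m) (2 + t)
    A₂ = C (1 + m) (2 + t)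
    A₃ = C m (2 + t)
    A₀  = C (1 + m) (suc t)
    q  = (3 + 2 * m) ∸ 2 * (2 + t)
    t<2+t : t < 2 + t
    t<2+t = m<n⇒m<1+n (n<1+n t)
    e₁ : (1 + (2 * t + 1)) ∸ t ≡ 2 + t
    e₁ = ∸-≡ (1 + (2 * t + 1)) t (2 + t) (solve (t ∷ []))
    e₂ : (2 * t + 1) ∸ suc t ≡ t
    e₂ = ∸-≡ (2 * t + 1) (suc t) t (solve (t ∷ []))
    e₃ : (2 * t + 1) ∸ t ≡ suc t
    e₃ = ∸-≡ (2 * t + 1) t (suc t) (solve (t ∷ []))
    e₄ : (3 + 2 * (2 * t + 1)) ∸ 2 * suc t ≡ 2 * t + 3
    e₄ = ∸-≡ (3 + 2 * (2 * t + 1)) (2 * suc t) (2 * t + 3) (solve (t ∷ []))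

  C-∸-vanish : ∀ a s k → a < s + suc k → C (a ∸ s) (suc k) ≡ 0
  C-∸-vanish a s k a<s+1+k = C-vanish (m<n+o⇒m∸n<o a s a<s+1+k)

  F-vanish : ∀ n k → n < k + suc k → F n (suc k) ≡ 0
  F-vanish n k n<2k+1 = trans (cong (C n (suc k) *_) (C-∸-vanish n k k n<2k+1)) (*-zeroʳ (C n (suc k)))

  G-vanish : ∀ m k → m < k + suc k → G m (suc (suc k)) ≡ 0
  G-vanish m k m<2k+1 = trans (cong (λ x → 2 * ((3 + 2 * m) ∸ 2 * suc k) * (C (1 + m) (suc k) * x)) (C-∸-vanish m k k m<2k+1))
    (trans (cong (2 * ((3 + 2 * m) ∸ 2 * suc k) *_) (*-zeroʳ (C (1 + m) (suc k)))) (*-zeroʳ (2 * ((3 + 2 * m) ∸ 2 * suc k))))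

  telescoping-beyond : ∀ m s → suc m < s + s → Telescoping m (suc s)
  telescoping-beyond m (suc s) 1+m<2s = trans
    (cong₂ _+_ (times-zero (3 + m) (F-vanish (2 + m) (suc s) (shift (s≤s 1+m<2s)))) (G-vanish m (suc s) (shift m<2s+1)))
    (sym (cong₂ _+_ (cong₂ _+_ (times-zero (2 * (3 + m)) (F-vanish (1 + m) (suc s) (shift (m<n⇒m<1+n 1+m<2s))))
                               (times-zero (3 * (1 + m)) (F-vanish m (suc s) (shift m<2s+1))))
                    (G-vanish m s (≤-pred 1+m<2s))))
    where
    times-zero : ∀ a {x} → x ≡ 0 → a * x ≡ 0
    times-zero a refl = *-zeroʳ a
    shift : ∀ {a} → a < suc (suc s + suc s) → a < suc s + suc (suc s)
    shift {a} = subst (a <_) (sym (+-suc (suc s) (suc s)))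
    m<2s+1 : m < suc (suc s + suc s)
    m<2s+1 = <-trans (n<1+n m) (m<n⇒m<1+n 1+m<2s)

  telescoping-within : ∀ m s j → s + s + j ≡ suc m → Telescoping m (suc s)
  telescoping-within m zero    zero    ()
  telescoping-within m (suc t) zero    2t+2≡1+m =
    subst (λ m → Telescoping m (suc (suc t))) (suc-injective (trans (2t+2 t) 2t+2≡1+m)) (telescoping-edge t)
    where
    2t+2 : ∀ t → suc (2 * t + 1) ≡ suc t + suc t + 0
    2t+2 = solve-∀
  telescoping-within m s       (suc i) 2s+1+i≡1+m =
    subst (λ m → Telescoping m (suc s)) (suc-injective (trans (2s+1+i s i) 2s+1+i≡1+m)) (telescoping-interior s i)
    where
    2s+1+i : ∀ s i → suc (2 * s + i) ≡ s + s + suc i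
    2s+1+i = solve-∀

  telescoping : ∀ m k → Telescoping m k
  telescoping m zero    = telescoping-zero m
  telescoping m (suc s) with suc m <? s + s
  ... | yes 1+m<2s = telescoping-beyond m s 1+m<2s
  ... | no  1+m≮2s = telescoping-within m s (suc m ∸ (s + s)) (m+[n∸m]≡n (≮⇒≥ 1+m≮2s))

  c : ℕ → ℕ
  c m = ∑ (suc m) (F m)

  F-outside : ∀ n k → n < k → F n k ≡ 0
  F-outside n k n<k = cong (_* C (suc n ∸ k) k) (C-vanish n<k)

  G-last : ∀ m → G m (3 + m) ≡ 0
  G-last m = trans (cong (λ x → 2 * ((3 + 2 * m) ∸ 2 * (2 + m)) * (x * C ((1 + m) ∸ (2 + m)) (2 + m))) (C-vanish (n<1+n (1 + m))))
                   (*-zeroʳ (2 * ((3 + 2 * m) ∸ 2 * (2 + m))))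

  c-recurrence : ∀ m → (3 + m) * c (2 + m) ≡ 2 * (3 + m) * c (1 + m) + 3 * (1 + m) * c m
  c-recurrence m = begin
      (3 + m) * c (2 + m)
    ≡⟨ ∑-distribˡ-* (3 + m) (3 + m) (F (2 + m)) ⟨
      ∑ (3 + m) (λ k → (3 + m) * F (2 + m) k)
    ≡⟨ telescoped ⟩
      ∑ (3 + m) (λ k → 2 * (3 + m) * F (1 + m) k + 3 * (1 + m) * F m k)
    ≡⟨ ∑-distrib-+ (3 + m) (λ k → 2 * (3 + m) * F (1 + m) k) (λ k → 3 * (1 + m) * F m k) ⟩
      ∑ (3 + m) (λ k → 2 * (3 + m) * F (1 + m) k) + ∑ (3 + m) (λ k → 3 * (1 + m) * F m k)
    ≡⟨ cong₂ _+_ (∑-distribˡ-* (3 + m) (2 * (3 + m)) (F (1 + m))) (∑-distribˡ-* (3 + m) (3 * (1 + m)) (F m)) ⟩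
      2 * (3 + m) * ∑ (3 + m) (F (1 + m)) + 3 * (1 + m) * ∑ (3 + m) (F m)
    ≡⟨ cong₂ (λ x y → 2 * (3 + m) * x + 3 * (1 + m) * y)
         (∑-extend (2 + m) (3 + m) (F (1 + m)) (n≤1+n (2 + m)) (λ k 2+m≤k → F-outside (1 + m) k 2+m≤k))
         (∑-extend (1 + m) (3 + m) (F m) (m≤n+m (1 + m) 2) (λ k 1+m≤k → F-outside m k 1+m≤k)) ⟩
      2 * (3 + m) * c (1 + m) + 3 * (1 + m) * c m
    ∎
    where
    open ≡-Reasoning
    telescoped : ∑ (3 + m) (λ k → (3 + m) * F (2 + m) k) ≡ ∑ (3 + m) (λ k → 2 * (3 + m) * F (1 + m) k + 3 * (1 + m) * F m k)
    telescoped = begin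
      ∑ (3 + m) (λ k → (3 + m) * F (2 + m) k)                    ≡⟨ +-identityʳ _ ⟨
      ∑ (3 + m) (λ k → (3 + m) * F (2 + m) k) + 0                ≡⟨ cong (∑ (3 + m) (λ k → (3 + m) * F (2 + m) k) +_) (G-last m) ⟨
      ∑ (3 + m) (λ k → (3 + m) * F (2 + m) k) + G m (3 + m)      ≡⟨ ∑-telescope (3 + m) _ _ (G m) (telescoping m) ⟩
      ∑ (3 + m) (λ k → 2 * (3 + m) * F (1 + m) k + 3 * (1 + m) * F m k) + 0  ≡⟨ +-identityʳ _ ⟩
      ∑ (3 + m) (λ k → 2 * (3 + m) * F (1 + m) k + 3 * (1 + m) * F m k)      ∎

  b-suc≡c : ∀ m → b (suc m) ≡ c m
  b-suc≡c m = begin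
    b (suc m)                           ≡⟨ b-suc≡paths m ⟩
    paths afterU m (suc m)              ≡⟨ paths-afterU-closed (suc (suc m)) m (suc m) (n<1+n (suc m)) ⟩
    binomialSum (suc (suc m)) m (suc m) ≡⟨ ∑-extend (suc m) (suc (suc m)) (F m) (n≤1+n (suc m)) (λ k 1+m≤k → F-outside m k 1+m≤k) ⟩
    c m                                 ∎
    where open ≡-Reasoning

open import Data.Integer using (ℤ; +_; -[1+_])

module PowerSeries where

  open import Data.List using (map; applyUpTo)
  open import Data.Nat as ℕ using (zero; suc; _∸_; _≤_; s≤s; z≤n)
  import Data.Nat.Properties as ℕ
  open import Data.Integer using (_+_; _*_; _-_)
  open import Data.Integer.Properties
  open import Data.Integer.Tactic.RingSolver
  open import Data.Sum using (inj₁; inj₂)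
  open import Relation.Binary.PropositionalEquality
  open FiniteSum +-*-commutativeSemiring

  -- _⊛_ with the list sum replaced by ∑, which unfolds by recursion on n.
  infixl 7 _⋆_

  _⋆_ : Series → Series → Series
  (f ⋆ g) n = ∑ (suc n) (λ i → f i * g (n ∸ i))

  ∑-applyUpTo : ∀ (h : ℕ → ℤ) g n → sumℤ (map h (applyUpTo g n)) ≡ ∑ n (λ i → h (g i))
  ∑-applyUpTo h g zero    = refl
  ∑-applyUpTo h g (suc n) = cong (λ x → h (g 0) + x) (∑-applyUpTo h (λ i → g (suc i)) n)

  ⊛≗⋆ : ∀ f g n → (f ⊛ g) n ≡ (f ⋆ g) n
  ⊛≗⋆ f g n = ∑-applyUpTo (λ i → f i * g (n ∸ i)) (λ i → i) (suc n)

  ⋆-cong : ∀ {f f′ g g′} → (∀ i → f i ≡ f′ i) → (∀ i → g i ≡ g′ i) → ∀ n → (f ⋆ g) n ≡ (f′ ⋆ g′) n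
  ⋆-cong {f} {f′} {g} {g′} f≗f′ g≗g′ n = ∑-cong (suc n) (λ i → f i * g (n ∸ i)) (λ i → f′ i * g′ (n ∸ i)) (λ i _ → cong₂ _*_ (f≗f′ i) (g≗g′ (n ∸ i)))

  ⋆-congʳ-≤ : ∀ f {g g′} n → (∀ i → i ≤ n → g i ≡ g′ i) → (f ⋆ g) n ≡ (f ⋆ g′) n
  ⋆-congʳ-≤ f {g} {g′} n g≗g′ = ∑-cong (suc n) (λ i → f i * g (n ∸ i)) (λ i → f i * g′ (n ∸ i)) (λ i _ → cong (f i *_) (g≗g′ (n ∸ i) (ℕ.m∸n≤m n i)))

  ⋆-distribʳ-+ : ∀ f h g n → ((λ i → f i + h i) ⋆ g) n ≡ (f ⋆ g) n + (h ⋆ g) n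
  ⋆-distribʳ-+ f h g n = trans (∑-cong (suc n) _ (λ i → f i * g (n ∸ i) + h i * g (n ∸ i)) (λ i _ → *-distribʳ-+ (g (n ∸ i)) (f i) (h i)))
    (∑-distrib-+ (suc n) (λ i → f i * g (n ∸ i)) (λ i → h i * g (n ∸ i)))

  ⋆-scaleˡ : ∀ a f g n → ((λ i → a * f i) ⋆ g) n ≡ a * (f ⋆ g) n
  ⋆-scaleˡ a f g n = trans (∑-cong (suc n) _ (λ i → a * (f i * g (n ∸ i))) (λ i _ → *-assoc a (f i) (g (n ∸ i))))
    (∑-distribˡ-* (suc n) a (λ i → f i * g (n ∸ i)))

  ⋆-comm : ∀ f g n → (f ⋆ g) n ≡ (g ⋆ f) n
  ⋆-comm f g n = trans (∑-reverse (suc n) (λ i → f i * g (n ∸ i))) (∑-cong (suc n) _ (λ i → g i * f (n ∸ i)) (λ i i≤n →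
    trans (cong (λ j → f (n ∸ i) * g j) (ℕ.m∸[m∸n]≡n (ℕ.≤-pred i≤n))) (*-comm (f (n ∸ i)) (g i))))

  ⋆-assoc : ∀ f g h n → ((f ⋆ g) ⋆ h) n ≡ (f ⋆ (g ⋆ h)) n
  ⋆-assoc f g h zero    = rearrange (f 0) (g 0) (h 0)
    where
    rearrange : ∀ a b c → (a * b + + 0) * c + + 0 ≡ a * (b * c + + 0) + + 0
    rearrange = solve-∀
  ⋆-assoc f g h (suc n) = begin
      (f 0 * g 0 + + 0) * h (suc n) + ((λ i → f 0 * g (suc i) + (f′ ⋆ g) i) ⋆ h) n
    ≡⟨ cong (λ x → (f 0 * g 0 + + 0) * h (suc n) + x) (⋆-distribʳ-+ (λ i → f 0 * g (suc i)) (f′ ⋆ g) h n) ⟩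
      (f 0 * g 0 + + 0) * h (suc n) + (((λ i → f 0 * g (suc i)) ⋆ h) n + ((f′ ⋆ g) ⋆ h) n)
    ≡⟨ cong₂ (λ x y → (f 0 * g 0 + + 0) * h (suc n) + (x + y)) (⋆-scaleˡ (f 0) (λ i → g (suc i)) h n) (⋆-assoc f′ g h n) ⟩
      (f 0 * g 0 + + 0) * h (suc n) + (f 0 * (g′ ⋆ h) n + (f′ ⋆ (g ⋆ h)) n)
    ≡⟨ rearrange (f 0) (g 0) (h (suc n)) _ _ ⟩
      f 0 * (g 0 * h (suc n) + (g′ ⋆ h) n) + (f′ ⋆ (g ⋆ h)) n
    ∎
    where
    open ≡-Reasoning
    f′ g′ : Series
    f′ i = f (suc i)
    g′ i = g (suc i)
    rearrange : ∀ a b c x y → (a * b + + 0) * c + (a * x + y) ≡ a * (b * c + x) + y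
    rearrange = solve-∀

  δ : Series → Series
  δ f i = + i * f i

  δ-suc : ∀ f i → δ f (suc i) ≡ f (suc i) + δ (λ j → f (suc j)) i
  δ-suc f i = trans (cong (_* f (suc i)) (pos-+ 1 i)) (trans (*-distribʳ-+ (f (suc i)) (+ 1) (+ i)) (cong (_+ + i * f (suc i)) (*-identityˡ (f (suc i)))))

  δ-⋆ : ∀ f g n → δ (f ⋆ g) n ≡ (δ f ⋆ g) n + (f ⋆ δ g) n
  δ-⋆ f g zero    = rearrange (f 0) (g 0)
    where
    rearrange : ∀ a b → + 0 * (a * b + + 0) ≡ (+ 0 * a * b + + 0) + (a * (+ 0 * b) + + 0)
    rearrange = solve-∀
  δ-⋆ f g (suc n) = begin
      + suc n * (f 0 * g (suc n) + (f′ ⋆ g) n)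
    ≡⟨ cong (_* (f 0 * g (suc n) + (f′ ⋆ g) n)) (pos-+ 1 n) ⟩
      (+ 1 + + n) * (f 0 * g (suc n) + (f′ ⋆ g) n)
    ≡⟨ expand (f 0) (g (suc n)) (+ n) ((f′ ⋆ g) n) ⟩
      f 0 * ((+ 1 + + n) * g (suc n)) + (f′ ⋆ g) n + + n * (f′ ⋆ g) n
    ≡⟨ cong (λ x → f 0 * ((+ 1 + + n) * g (suc n)) + (f′ ⋆ g) n + x) (δ-⋆ f′ g n) ⟩
      f 0 * ((+ 1 + + n) * g (suc n)) + (f′ ⋆ g) n + ((δ f′ ⋆ g) n + (f′ ⋆ δ g) n)
    ≡⟨ regroup (f 0) (g (suc n)) (+ n) ((f′ ⋆ g) n) ((δ f′ ⋆ g) n) ((f′ ⋆ δ g) n) ⟩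
      (+ 0 * f 0 * g (suc n) + ((f′ ⋆ g) n + (δ f′ ⋆ g) n)) + (f 0 * ((+ 1 + + n) * g (suc n)) + (f′ ⋆ δ g) n)
    ≡⟨ cong₂ (λ x y → (+ 0 * f 0 * g (suc n) + x) + (f 0 * (y * g (suc n)) + (f′ ⋆ δ g) n))
         (trans (⋆-cong {g = g} {g′ = g} (δ-suc f) (λ _ → refl) n) (⋆-distribʳ-+ f′ (δ f′) g n)) (pos-+ 1 n) ⟨
      (δ f ⋆ g) (suc n) + (f ⋆ δ g) (suc n)
    ∎
    where
    open ≡-Reasoning
    f′ : Series
    f′ i = f (suc i)
    expand : ∀ a b N A → (+ 1 + N) * (a * b + A) ≡ a * ((+ 1 + N) * b) + A + N * A
    expand = solve-∀
    regroup : ∀ a b N A x y → a * ((+ 1 + N) * b) + A + (x + y) ≡ (+ 0 * a * b + (A + x)) + (a * ((+ 1 + N) * b) + y)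
    regroup = solve-∀

  -- The equation 2P·zX′ = zP′·X, satisfied by X = √P.
  Solves : Series → Series → Set
  Solves P X = ∀ n → + 2 * (P ⋆ δ X) n ≡ (δ P ⋆ X) n

  square-root-solves : ∀ P S → (∀ n → (S ⋆ S) n ≡ P n) → Solves P S
  square-root-solves P S S²≗P n = begin
      + 2 * (P ⋆ δ S) n
    ≡⟨ cong (+ 2 *_) (⋆-cong {g = δ S} {g′ = δ S} (λ i → sym (S²≗P i)) (λ _ → refl) n) ⟩
      + 2 * ((S ⋆ S) ⋆ δ S) n
    ≡⟨ cong (+ 2 *_) (trans (⋆-assoc S S (δ S) n) (⋆-comm S (S ⋆ δ S) n)) ⟩
      + 2 * ((S ⋆ δ S) ⋆ S) n
    ≡⟨ ⋆-scaleˡ (+ 2) (S ⋆ δ S) S n ⟨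
      ((λ i → + 2 * (S ⋆ δ S) i) ⋆ S) n
    ≡⟨ ⋆-cong {g = S} {g′ = S} (λ i → sym (δP≗2SδS i)) (λ _ → refl) n ⟩
      (δ P ⋆ S) n
    ∎
    where
    open ≡-Reasoning
    δP≗2SδS : ∀ i → δ P i ≡ + 2 * (S ⋆ δ S) i
    δP≗2SδS i = begin
      + i * P i                         ≡⟨ cong (+ i *_) (S²≗P i) ⟨
      δ (S ⋆ S) i                       ≡⟨ δ-⋆ S S i ⟩
      (δ S ⋆ S) i + (S ⋆ δ S) i         ≡⟨ cong (_+ (S ⋆ δ S) i) (⋆-comm (δ S) S i) ⟩
      (S ⋆ δ S) i + (S ⋆ δ S) i         ≡⟨ double ((S ⋆ δ S) i) ⟩
      + 2 * (S ⋆ δ S) i                 ∎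
      where
      double : ∀ x → x + x ≡ + 2 * x
      double = solve-∀

  solution-unique : ∀ P X Y → P 0 ≡ + 1 → Solves P X → Solves P Y → X 0 ≡ Y 0 → ∀ n → X n ≡ Y n
  solution-unique P X Y P₀≡1 solX solY X₀≡Y₀ n = agree n n ℕ.≤-refl
    where
    isolate : ∀ p N x A C → p ≡ + 1 → + 2 * (p * (N * x) + A) ≡ + 0 + C → + 2 * N * x ≡ C - + 2 * A
    isolate _ N x A C refl eq = trans (rearrange N x A) (cong (_- + 2 * A) (trans eq (+-identityˡ C)))
      where
      rearrange : ∀ N x A → + 2 * N * x ≡ + 2 * (+ 1 * (N * x) + A) - + 2 * A
      rearrange = solve-∀
    -- The coefficient of z^(n+1) in Solves P X is 2(n+1)·X (n+1) plus terms in X 0, …, X n.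
    next : ∀ n → (∀ i → i ≤ n → X i ≡ Y i) → X (suc n) ≡ Y (suc n)
    next n X≗Y = *-cancelˡ-≡ (+ 2 * + suc n) (X (suc n)) (Y (suc n)) (begin
        + 2 * + suc n * X (suc n)
      ≡⟨ isolate (P 0) (+ suc n) (X (suc n)) ((P′ ⋆ δ X) n) ((δP′ ⋆ X) n) P₀≡1 (solX (suc n)) ⟩
        (δP′ ⋆ X) n - + 2 * (P′ ⋆ δ X) n
      ≡⟨ cong₂ (λ x y → x - + 2 * y) (⋆-congʳ-≤ δP′ n X≗Y) (⋆-congʳ-≤ P′ n (λ i i≤n → cong (+ i *_) (X≗Y i i≤n))) ⟩
        (δP′ ⋆ Y) n - + 2 * (P′ ⋆ δ Y) n
      ≡⟨ isolate (P 0) (+ suc n) (Y (suc n)) ((P′ ⋆ δ Y) n) ((δP′ ⋆ Y) n) P₀≡1 (solY (suc n)) ⟨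
        + 2 * + suc n * Y (suc n)
      ∎)
      where
      open ≡-Reasoning
      P′ δP′ : Series
      P′  i = P (suc i)
      δP′ i = δ P (suc i)
    agree : ∀ n i → i ≤ n → X i ≡ Y i
    agree zero    zero z≤n = X₀≡Y₀
    agree (suc n) i i≤1+n with ℕ.m≤n⇒m<n∨m≡n i≤1+n
    ... | inj₁ (s≤s i≤n) = agree n i i≤n
    ... | inj₂ refl      = next n (agree n)

  −ˢ-swap : ∀ f g h n → g n ≡ (f −ˢ h) n → h n ≡ (f −ˢ g) n
  −ˢ-swap f g h n gₙ≡fₙ-hₙ = trans (sym (f-[f-x]≡x (f n) (h n))) (cong (f n -_) (sym gₙ≡fₙ-hₙ))
    where
    f-[f-x]≡x : ∀ a x → a - (a - x) ≡ x
    f-[f-x]≡x = solve-∀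

  poly-single-⋆ : ∀ a X n → (poly (a ∷ []) ⋆ X) n ≡ a * X n
  poly-single-⋆ a X n = trans (cong (λ x → a * X n + x) (∑-zero n (λ i → + 0 * X (n ∸ suc i)) (λ _ _ → refl))) (+-identityʳ (a * X n))

  quadratic-⋆ : ∀ a₀ a₁ a₂ X k → (poly (a₀ ∷ a₁ ∷ a₂ ∷ []) ⋆ X) (suc (suc k)) ≡ a₀ * X (suc (suc k)) + (a₁ * X (suc k) + a₂ * X k)
  quadratic-⋆ a₀ a₁ a₂ X k = cong (λ x → a₀ * X (suc (suc k)) + (a₁ * X (suc k) + x)) (poly-single-⋆ a₂ X k)

module GeneratingFunction where

  open import Data.Nat as ℕ using (suc)
  open import Data.Integer using (_+_; _*_; _-_)
  open import Data.Integer.Properties using (*-zeroʳ; pos-*)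
  open import Data.Integer.Tactic.RingSolver
  open import Relation.Binary.PropositionalEquality
  open PowerSeries
  open Recurrence using (c; c-recurrence; b-suc≡c)

  Δ : Series
  Δ = poly (+ 1 ∷ -[1+ 1 ] ∷ -[1+ 2 ] ∷ [])

  δΔ≗ : ∀ i → δ Δ i ≡ poly (+ 0 ∷ -[1+ 1 ] ∷ -[1+ 5 ] ∷ []) i
  δΔ≗ 0                   = refl
  δΔ≗ 1                   = refl
  δΔ≗ 2                   = refl
  δΔ≗ (suc (suc (suc i))) = *-zeroʳ (+ suc (suc (suc i)))

  -- The coefficient of z^(K+2) in Solves Δ X.
  ΔRecurrence : ℤ → ℤ → ℤ → ℤ → Set
  ΔRecurrence K x₂ x₁ x₀ =
    + 2 * (+ 1 * ((+ 2 + K) * x₂) + (-[1+ 1 ] * ((+ 1 + K) * x₁) + -[1+ 2 ] * (K * x₀)))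
      ≡ + 0 * x₂ + (-[1+ 1 ] * x₁ + -[1+ 5 ] * x₀)

  cancel-multiples : ∀ L R x y u v → x ≡ y → u ≡ v → L ≡ R + (+ 4 * (x - y) - + 12 * (u - v)) → L ≡ R
  cancel-multiples L R x _ u _ refl refl L≡R+0 = trans L≡R+0 (R+0≡R R x u)
    where
    R+0≡R : ∀ R x u → R + (+ 4 * (x - x) - + 12 * (u - u)) ≡ R
    R+0≡R = solve-∀

  -- T (j + 2) = 2 c (j + 1) − 6 c j, and the Δ-recurrence for these values is
  -- 4 times the recurrence for c at j + 1 minus 12 times the one at j.
  difference-recurrence : ∀ J c₀ c₁ c₂ c₃ →
    (+ 4 + J) * c₃ ≡ + 2 * (+ 4 + J) * c₂ + + 3 * (+ 2 + J) * c₁ →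
    (+ 3 + J) * c₂ ≡ + 2 * (+ 3 + J) * c₁ + + 3 * (+ 1 + J) * c₀ →
    ΔRecurrence (+ 2 + J) (+ 2 * c₃ - + 6 * c₂) (+ 2 * c₂ - + 6 * c₁) (+ 2 * c₁ - + 6 * c₀)
  difference-recurrence J c₀ c₁ c₂ c₃ rec₁ rec₀ =
    cancel-multiples _ _ _ _ _ _ rec₁ rec₀ (solve (J ∷ c₀ ∷ c₁ ∷ c₂ ∷ c₃ ∷ []))

  pos-*-*  : ∀ a b x → + (a ℕ.* b ℕ.* x) ≡ + a * + b * + x
  pos-*-* a b x = trans (pos-* (a ℕ.* b) x) (cong (_* + x) (pos-* a b))

  c-recurrenceℤ : ∀ m → + (3 ℕ.+ m) * + c (2 ℕ.+ m) ≡ + 2 * + (3 ℕ.+ m) * + c (1 ℕ.+ m) + + 3 * + (1 ℕ.+ m) * + c m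
  c-recurrenceℤ m = begin
    + (3 ℕ.+ m) * + c (2 ℕ.+ m)                                              ≡⟨ pos-* (3 ℕ.+ m) (c (2 ℕ.+ m)) ⟨
    + ((3 ℕ.+ m) ℕ.* c (2 ℕ.+ m))                                            ≡⟨ cong +_ (c-recurrence m) ⟩
    + (2 ℕ.* (3 ℕ.+ m) ℕ.* c (1 ℕ.+ m)) + + (3 ℕ.* (1 ℕ.+ m) ℕ.* c m)       ≡⟨ cong₂ _+_ (pos-*-* 2 (3 ℕ.+ m) (c (1 ℕ.+ m))) (pos-*-* 3 (1 ℕ.+ m) (c m)) ⟩
    + 2 * + (3 ℕ.+ m) * + c (1 ℕ.+ m) + + 3 * + (1 ℕ.+ m) * + c m            ∎
    where open ≡-Reasoning

  T : Series
  T = poly (+ 1 ∷ -[1+ 2 ] ∷ []) −ˢ (poly (-[1+ 1 ] ∷ + 6 ∷ []) ⊛ B)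

  T-suc-suc : ∀ j → T (suc (suc j)) ≡ + 2 * + c (suc j) - + 6 * + c j
  T-suc-suc j = begin
    + 0 - (poly (-[1+ 1 ] ∷ + 6 ∷ []) ⊛ B) (suc (suc j))  ≡⟨ cong (+ 0 -_) (⊛≗⋆ (poly (-[1+ 1 ] ∷ + 6 ∷ [])) B (suc (suc j))) ⟩
    + 0 - (-[1+ 1 ] * + b (suc (suc j)) + (poly (+ 6 ∷ []) ⋆ B) (suc j))
      ≡⟨ cong₂ (λ x y → + 0 - (-[1+ 1 ] * + x + y)) (b-suc≡c (suc j)) (trans (poly-single-⋆ (+ 6) B (suc j)) (cong (λ x → + 6 * + x) (b-suc≡c j))) ⟩
    + 0 - (-[1+ 1 ] * + c (suc j) + + 6 * + c j)         ≡⟨ rearrange (+ c (suc j)) (+ c j) ⟩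
    + 2 * + c (suc j) - + 6 * + c j                      ∎
    where
    open ≡-Reasoning
    rearrange : ∀ x y → + 0 - (-[1+ 1 ] * x + + 6 * y) ≡ + 2 * x - + 6 * y
    rearrange = solve-∀

  T-recurrence : ∀ k → ΔRecurrence (+ k) (T (2 ℕ.+ k)) (T (1 ℕ.+ k)) (T k)
  T-recurrence 0             = refl  -- these two cases evaluate b 1, b 2 and b 3
  T-recurrence 1             = refl
  T-recurrence (suc (suc j)) =
    transport {K = + (2 ℕ.+ j)} (T-suc-suc (2 ℕ.+ j)) (T-suc-suc (1 ℕ.+ j)) (T-suc-suc j)
      (difference-recurrence (+ j) (+ c j) (+ c (1 ℕ.+ j)) (+ c (2 ℕ.+ j)) (+ c (3 ℕ.+ j)) (c-recurrenceℤ (1 ℕ.+ j)) (c-recurrenceℤ j))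
    where
    transport : ∀ {K x₂ x₁ x₀ y₂ y₁ y₀} → x₂ ≡ y₂ → x₁ ≡ y₁ → x₀ ≡ y₀ → ΔRecurrence K y₂ y₁ y₀ → ΔRecurrence K x₂ x₁ x₀
    transport refl refl refl rec = rec

  T-solves : Solves Δ T
  T-solves 0             = refl
  T-solves 1             = refl
  T-solves (suc (suc k)) = begin
      + 2 * (Δ ⋆ δ T) (suc (suc k))
    ≡⟨ cong (+ 2 *_) (quadratic-⋆ (+ 1) -[1+ 1 ] -[1+ 2 ] (δ T) k) ⟩
      + 2 * (+ 1 * δ T (2 ℕ.+ k) + (-[1+ 1 ] * δ T (1 ℕ.+ k) + -[1+ 2 ] * δ T k))
    ≡⟨ T-recurrence k ⟩
      + 0 * T (2 ℕ.+ k) + (-[1+ 1 ] * T (1 ℕ.+ k) + -[1+ 5 ] * T k)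
    ≡⟨ trans (⋆-cong {g = T} {g′ = T} δΔ≗ (λ _ → refl) (suc (suc k))) (quadratic-⋆ (+ 0) -[1+ 1 ] -[1+ 5 ] T k) ⟨
      (δ Δ ⋆ T) (suc (suc k))
    ∎
    where open ≡-Reasoning

open PowerSeries using (Solves; ⊛≗⋆; −ˢ-swap; square-root-solves; solution-unique)
open GeneratingFunction using (Δ; T; T-solves)
open import Relation.Binary.PropositionalEquality using (refl; sym; trans)

corollary2 : (S : Series) → S 0 ≡ + 1 →
    (∀ n → (S ⊛ S) n ≡ poly (+ 1 ∷ -[1+ 1 ] ∷ -[1+ 2 ] ∷ []) n) →
    ∀ n → (poly (-[1+ 1 ] ∷ + 6 ∷ []) ⊛ B) n ≡ (poly (+ 1 ∷ -[1+ 2 ] ∷ []) −ˢ S) n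
corollary2 S S₀≡1 S²≡Δ n = −ˢ-swap (poly (+ 1 ∷ -[1+ 2 ] ∷ [])) S (poly (-[1+ 1 ] ∷ + 6 ∷ []) ⊛ B) n (S≗T n)
  where
  S-solves : Solves Δ S
  S-solves = square-root-solves Δ S (λ n → trans (sym (⊛≗⋆ S S n)) (S²≡Δ n))
  S≗T : ∀ n → S n ≡ T n
  S≗T = solution-unique Δ S T refl S-solves T-solves S₀≡1
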